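{- Let $q$ be an odd prime power and $d\in\mathbb{F}_q\setminus\{0,1\}$. (i) Let $s\in\mathbb{F}_q$ with $s^2=d$, and let $P\in L_d(\mathbb{F}_q)$ have $x$-coordinate $s$. Then $P\in 2L_d(\mathbb{F}_q)$ if and only if $s$, $s-1$ and $s-d$ are all nonzero squares in $\mathbb{F}_q$. (ii) Let $t\in\mathbb{F}_q$ with $t^2 = 1-d$, and let $P\in L_d(\mathbb{F}_q)$ have $x$-coordinate $1+t$. Then $P\in 2L_d(\mathbb{F}_q)$ if and only if $1+t$, $t$ and $1+t-d$ are all nonzero squares in $\mathbb{F}_q$. (iii) Let $u\in\mathbb{F}_q$ with $u^2 = d(d-1)$, and let $P\in L_d(\mathbb{F}_q)$ have $x$-coordinate $d+u$. Then $P\in 2L_d(\mathbb{F}_q)$ if and only if $d+u$, $d+u-1$ and $u$ are all nonzero squares in $\mathbb{F}_q$.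
   Context: $L_d$ is the Legendre elliptic curve $y^2=x(x-1)(x-d)$ over $\mathbb{F}_q$ and $2L_d(\mathbb{F}_q)=\{2Q : Q\in L_d(\mathbb{F}_q)\}$. The points in (i), (ii), (iii) are the $\mathbb{F}_q$-rational points of order $4$ whose doubles are $(0,0)$, $(1,0)$, $(d,0)$ respectively (the points $(\pm\sqrt d, \sqrt{ -1}\sqrt d(1\mp\sqrt d))$, $(1\pm\sqrt{1-d}, \sqrt{1-d}(1\pm\sqrt{1-d}))$, $(d\pm\sqrt{d(d-1)}, \sqrt{d(d-1)}(\sqrt d\pm\sqrt{d-1}))$ and their negatives, when rational). -}

module Defs where

open import Level using (0ℓ)
open import Algebra.Bundles using (CommutativeRing)
open import Data.Nat as ℕ using (ℕ; _^_; _<_)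
open import Data.Nat.Divisibility using (_∣_)
open import Data.Nat.Primality using (Prime)
open import Data.Fin using (Fin)
open import Data.Maybe using (Maybe; just; nothing)
open import Data.Product using (_×_; _,_; ∃; Σ)
open import Data.Empty using (⊥)
open import Relation.Nullary using (¬_; Dec; yes; no)
open import Relation.Binary.PropositionalEquality using (_≡_)

record FiniteOddField : Set₁ where
  field
    cring : CommutativeRing 0ℓ 0ℓ
  open CommutativeRing cring public
  field
    _≟_     : (x y : Carrier) → Dec (x ≈ y)
    0≉1     : ¬ (0# ≈ 1#)
    inv     : Carrier → Carrier
    inv-r   : ∀ x → ¬ (x ≈ 0#) → x * inv x ≈ 1#
    q       : ℕ
    enum    : Fin q → Carrier
    enum-inj  : ∀ i j → enum i ≈ enum j → i ≡ j
    enum-surj : ∀ x → ∃ λ i → enum i ≈ x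
    p       : ℕ
    k       : ℕ
    p-prime : Prime p
    k-pos   : 0 < k
    q≡pᵏ    : q ≡ p ^ k
    q-odd   : ¬ (2 ∣ q)

module Legendre (F : FiniteOddField) where
  open FiniteOddField F

  two three : Carrier
  two = 1# + 1#
  three = two + 1#

  rhs : Carrier → Carrier → Carrier
  rhs d x = x * (x - 1#) * (x - d)

  -- projective points: nothing = point at infinity O, just (x , y) an affine point
  Point : Set
  Point = Maybe (Carrier × Carrier)

  OnCurve : Carrier → Point → Set
  OnCurve d nothing = Data.Unit.⊤ where import Data.Unit
  OnCurve d (just (x , y)) = y * y ≈ rhs d x

  _≈P_ : Point → Point → Set
  nothing ≈P nothing = Data.Unit.⊤ where import Data.Unit
  nothing ≈P just _ = ⊥
  just _ ≈P nothing = ⊥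
  just (x , y) ≈P just (x' , y') = (x ≈ x') × (y ≈ y')

  -- doubling via the tangent (chord-tangent group law with O as identity)
  -- curve: y² = x³ + a x² + b x with a = -(1+d), b = d
  dbl : Carrier → Point → Point
  dbl d nothing = nothing
  dbl d (just (x , y)) with y ≟ 0#
  ... | yes _ = nothing
  ... | no _ =
        let a  = - (1# + d)
            lam = (three * x * x + two * a * x + d) * inv (two * y)
            x' = lam * lam - a - two * x
            y' = lam * (x - x') - y
        in just (x' , y')

  InTwoL : Carrier → Point → Set
  InTwoL d P = ∃ λ (Q : Point) → OnCurve d Q × (dbl d Q ≈P P)

  NZSquare : Carrier → Set
  NZSquare a = (a ≉ 0#) × ∃ λ b → b * b ≈ a

module Submission where

-- The proof follows the classical 2-descent description of 2L_d.  For an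
-- affine point P = (x₀, y₀) whose x-coordinate differs from each of the
-- roots 0, 1, d of the cubic, P is a double iff x₀, x₀-1 and x₀-d are all
-- squares:
--   * necessity: if P = 2Q, Q = (x, y), then x(2Q) - e = (N_e(x)/2y)² for
--     every root e, where N_e is an explicit quadratic (three polynomial
--     identities, combined with y² = x(x-1)(x-d));
--   * sufficiency: from square roots r₁, r₂, r₃ of x₀, x₀-1, x₀-d the point
--     (x₀ + r₁r₂ + r₁r₃ + r₂r₃, (r₁+r₂)(r₁+r₃)(r₂+r₃)) lies on L_d and
--     doubles to (x₀, r₁r₂r₃); replacing r₁ by -r₁ fixes the sign of y₀.
-- The theorem follows because each 4-torsion x-coordinate s, 1+t, d+u has
-- nonzero differences with 0, 1 and d.

open import Defs
open import Data.Product using (_×_; _,_; proj₁; proj₂; ∃)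
open import Data.Maybe using (Maybe; just; nothing)
open import Function.Bundles using (_⇔_; mk⇔; module Equivalence)

open import Level using (0ℓ)
open import Algebra.Bundles using (CommutativeRing; RawRing)
open import Data.Nat as ℕ using (ℕ; zero; suc; _<?_)
import Data.Nat.Properties as ℕP
open import Data.Nat.Divisibility using (_∣_; divides)
open import Data.Integer as ℤ using (ℤ; +_; -[1+_]; _⊖_; _◃_; sign; ∣_∣)
import Data.Integer.Properties as ℤP
open import Data.Sign as Sign using (Sign)
open import Data.Fin using (Fin; toℕ)
open import Data.Fin.Properties using (toℕ-injective)
import Data.Fin.Permutation as Perm
open import Data.Sum using (_⊎_; inj₁; inj₂)
open import Data.Empty using (⊥-elim)
open import Relation.Nullary using (yes; no; ¬_)
open import Relation.Binary.PropositionalEquality as P using (_≡_)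

-- A fixed-point-free involution τ of Fin n pairs up the elements, so n is
-- even.  This is what rules out characteristic 2 in a field of odd order.
module FixedPointFreeInvolution where
  open import Algebra.Properties.CommutativeMonoid.Sum ℕP.+-0-commutativeMonoid
    using (sum; sum-cong-≗; ∑-distrib-+; sum-permute)
  open P.≡-Reasoning

  less : ℕ → ℕ → ℕ
  less m n with m <? n
  ... | yes _ = 1
  ... | no _ = 0

  less-exclusive : ∀ m n → ¬ (m ≡ n) → less m n ℕ.+ less n m ≡ 1
  less-exclusive m n m≢n with m <? n | n <? m
  ... | yes m<n | yes n<m = ⊥-elim (ℕP.<-asym m<n n<m)
  ... | yes _   | no _    = P.refl
  ... | no _    | yes _   = P.refl
  ... | no m≮n  | no n≮m = ⊥-elim (m≢n (ℕP.≤-antisym (ℕP.≮⇒≥ n≮m) (ℕP.≮⇒≥ m≮n)))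

  sum-ones : ∀ n → sum {n} (λ _ → 1) ≡ n
  sum-ones zero = P.refl
  sum-ones (suc n) = P.cong suc (sum-ones n)

  -- count the i with i < τ i: every 2-cycle {i, τ i} contributes exactly
  -- once to this count and once to the count of i with τ i < i
  even-order : ∀ n (τ : Fin n → Fin n) →
               (∀ i → τ (τ i) ≡ i) → (∀ i → ¬ (τ i ≡ i)) → 2 ∣ n
  even-order n τ involutive fixed-point-free = divides (sum up) n≡up*2
    where
    up : Fin n → ℕ
    up i = less (toℕ i) (toℕ (τ i))
    τ-perm : Perm.Permutation n n
    τ-perm = Perm.permutation τ τ involutive involutive
    pair : ∀ i → up i ℕ.+ up (τ i) ≡ 1
    pair i rewrite involutive i =
      less-exclusive (toℕ i) (toℕ (τ i)) (λ e → fixed-point-free i (P.sym (toℕ-injective e)))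
    n≡up*2 : n ≡ sum up ℕ.* 2
    n≡up*2 = begin
      n                               ≡⟨ P.sym (sum-ones n) ⟩
      sum {n} (λ _ → 1)               ≡⟨ sum-cong-≗ (λ i → P.sym (pair i)) ⟩
      sum (λ i → up i ℕ.+ up (τ i))   ≡⟨ ∑-distrib-+ up (λ i → up (τ i)) ⟩
      sum up ℕ.+ sum (λ i → up (τ i)) ≡⟨ P.cong (sum up ℕ.+_) (P.sym (sum-permute up τ-perm)) ⟩
      sum up ℕ.+ sum up               ≡⟨ P.cong (sum up ℕ.+_) (P.sym (ℕP.+-identityʳ (sum up))) ⟩
      2 ℕ.* sum up                    ≡⟨ ℕP.*-comm 2 (sum up) ⟩
      sum up ℕ.* 2                    ∎

-- The ring solver of Algebra.Solver.Ring with integer coefficients, valid in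
-- every commutative ring: constants are interpreted through the canonical
-- ring homomorphism ℤ → R, so normal forms compute with closed integers.
module IntegerCoefficientSolver (R : CommutativeRing 0ℓ 0ℓ) where
  open CommutativeRing R
  open import Algebra.Properties.Semiring.Mult.TCOptimised semiring
    using (×-homo-+; ×1-homo-*; 1+×) renaming (_×_ to _·_)
  open import Algebra.Properties.Ring ring using (-0#≈0#; -‿involutive; -‿distribˡ-*; -‿distribʳ-*)
  open import Algebra.Properties.AbelianGroup +-abelianGroup using (⁻¹-∙-comm)
  open import Relation.Binary.Reasoning.Setoid setoid
  import Algebra.Solver.Ring.AlmostCommutativeRing as ACR

  fromℤ : ℤ → Carrier
  fromℤ (+ n) = n · 1#
  fromℤ -[1+ n ] = - (suc n · 1#)

  signed : Sign → Carrier → Carrier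
  signed Sign.+ x = x
  signed Sign.- x = - x

  signed-cong : ∀ s {x y} → x ≈ y → signed s x ≈ signed s y
  signed-cong Sign.+ x≈y = x≈y
  signed-cong Sign.- x≈y = -‿cong x≈y

  signed-* : ∀ s t x y → signed (s Sign.* t) (x * y) ≈ signed s x * signed t y
  signed-* Sign.+ Sign.+ x y = refl
  signed-* Sign.+ Sign.- x y = -‿distribʳ-* x y
  signed-* Sign.- Sign.+ x y = -‿distribˡ-* x y
  signed-* Sign.- Sign.- x y = begin
    x * y           ≈⟨ -‿involutive (x * y) ⟨
    - - (x * y)     ≈⟨ -‿cong (-‿distribʳ-* x y) ⟩
    - (x * - y)     ≈⟨ -‿distribˡ-* x (- y) ⟩
    - x * - y       ∎

  fromℤ-◃ : ∀ s n → fromℤ (s ◃ n) ≈ signed s (n · 1#)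
  fromℤ-◃ Sign.+ zero = refl
  fromℤ-◃ Sign.- zero = sym -0#≈0#
  fromℤ-◃ Sign.+ (suc n) = refl
  fromℤ-◃ Sign.- (suc n) = refl

  fromℤ-signAbs : ∀ i → fromℤ i ≈ signed (sign i) (∣ i ∣ · 1#)
  fromℤ-signAbs i = trans (reflexive (P.cong fromℤ (P.sym (ℤP.◃-inverse i)))) (fromℤ-◃ (sign i) ∣ i ∣)

  shift-difference : ∀ a b → a - b ≈ (1# + a) - (1# + b)
  shift-difference a b = begin
    a - b                  ≈⟨ +-identityˡ (a - b) ⟨
    0# + (a - b)           ≈⟨ +-congʳ (-‿inverseʳ 1#) ⟨
    (1# - 1#) + (a - b)    ≈⟨ +-assoc 1# (- 1#) (a - b) ⟩
    1# + (- 1# + (a - b))  ≈⟨ +-congˡ (+-assoc (- 1#) a (- b)) ⟨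
    1# + ((- 1# + a) - b)  ≈⟨ +-congˡ (+-congʳ (+-comm (- 1#) a)) ⟩
    1# + ((a - 1#) - b)    ≈⟨ +-congˡ (+-assoc a (- 1#) (- b)) ⟩
    1# + (a + (- 1# - b))  ≈⟨ +-congˡ (+-congˡ (⁻¹-∙-comm 1# b)) ⟩
    1# + (a - (1# + b))    ≈⟨ +-assoc 1# a (- (1# + b)) ⟨
    (1# + a) - (1# + b)    ∎

  fromℤ-⊖ : ∀ m n → fromℤ (m ⊖ n) ≈ m · 1# - n · 1#
  fromℤ-⊖ m zero = sym (trans (+-congˡ -0#≈0#) (+-identityʳ _))
  fromℤ-⊖ zero (suc n) = sym (+-identityˡ _)
  fromℤ-⊖ (suc m) (suc n) = begin
    fromℤ (suc m ⊖ suc n)        ≡⟨ P.cong fromℤ (ℤP.[1+m]⊖[1+n]≡m⊖n m n) ⟩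
    fromℤ (m ⊖ n)                ≈⟨ fromℤ-⊖ m n ⟩
    m · 1# - n · 1#              ≈⟨ shift-difference (m · 1#) (n · 1#) ⟩
    (1# + m · 1#) - (1# + n · 1#) ≈⟨ +-cong (1+× m 1#) (-‿cong (1+× n 1#)) ⟨
    suc m · 1# - suc n · 1#      ∎

  fromℤ-+ : ∀ i j → fromℤ (i ℤ.+ j) ≈ fromℤ i + fromℤ j
  fromℤ-+ (+ m) (+ n) = ×-homo-+ 1# m n
  fromℤ-+ (+ m) -[1+ n ] = fromℤ-⊖ m (suc n)
  fromℤ-+ -[1+ m ] (+ n) = trans (fromℤ-⊖ n (suc m)) (+-comm _ _)
  fromℤ-+ -[1+ m ] -[1+ n ] = begin
    - (suc (suc (m ℕ.+ n)) · 1#)  ≡⟨ P.cong (λ k → - (suc k · 1#)) (P.sym (ℕP.+-suc m n)) ⟩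
    - ((suc m ℕ.+ suc n) · 1#)    ≈⟨ -‿cong (×-homo-+ 1# (suc m) (suc n)) ⟩
    - (suc m · 1# + suc n · 1#)   ≈⟨ ⁻¹-∙-comm (suc m · 1#) (suc n · 1#) ⟨
    - (suc m · 1#) - suc n · 1#   ∎

  fromℤ-* : ∀ i j → fromℤ (i ℤ.* j) ≈ fromℤ i * fromℤ j
  fromℤ-* i j = begin
    fromℤ (sign i Sign.* sign j ◃ ∣ i ∣ ℕ.* ∣ j ∣)       ≈⟨ fromℤ-◃ (sign i Sign.* sign j) (∣ i ∣ ℕ.* ∣ j ∣) ⟩
    signed (sign i Sign.* sign j) ((∣ i ∣ ℕ.* ∣ j ∣) · 1#) ≈⟨ signed-cong (sign i Sign.* sign j) (×1-homo-* ∣ i ∣ ∣ j ∣) ⟩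
    signed (sign i Sign.* sign j) ((∣ i ∣ · 1#) * (∣ j ∣ · 1#)) ≈⟨ signed-* (sign i) (sign j) _ _ ⟩
    signed (sign i) (∣ i ∣ · 1#) * signed (sign j) (∣ j ∣ · 1#) ≈⟨ *-cong (fromℤ-signAbs i) (fromℤ-signAbs j) ⟨
    fromℤ i * fromℤ j                                      ∎

  fromℤ-neg : ∀ i → fromℤ (ℤ.- i) ≈ - fromℤ i
  fromℤ-neg (+ zero) = sym -0#≈0#
  fromℤ-neg (+ suc n) = refl
  fromℤ-neg -[1+ n ] = sym (-‿involutive _)

  ℤ-rawRing : RawRing 0ℓ 0ℓ
  ℤ-rawRing = record
    { Carrier = ℤ ; _≈_ = _≡_ ; _+_ = ℤ._+_ ; _*_ = ℤ._*_ ; -_ = ℤ.-_ ; 0# = + 0 ; 1# = + 1 }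

  fromℤ-homomorphism : ℤ-rawRing ACR.-Raw-AlmostCommutative⟶ ACR.fromCommutativeRing R
  fromℤ-homomorphism = record
    { ⟦_⟧ = fromℤ ; +-homo = fromℤ-+ ; *-homo = fromℤ-* ; -‿homo = fromℤ-neg ; 0-homo = refl ; 1-homo = refl }

  coefficients-equal : ∀ i j → Maybe (fromℤ i ≈ fromℤ j)
  coefficients-equal i j with i ℤ.≟ j
  ... | yes P.refl = just refl
  ... | no _ = nothing

  open import Algebra.Solver.Ring ℤ-rawRing (ACR.fromCommutativeRing R) fromℤ-homomorphism coefficients-equal public

module FieldFacts (F : FiniteOddField) where
  open FiniteOddField F
  open Legendre F using (two; NZSquare)
  open IntegerCoefficientSolver cring
  open import Algebra.Properties.Ring ring using (-0#≈0#; -‿involutive)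
  open import Algebra.Properties.Group +-group using (x∙y⁻¹≈ε⇒x≈y; x≈y⇒x∙y⁻¹≈ε)
  open import Relation.Binary.Reasoning.Setoid setoid

  -- the characteristic is not 2: otherwise x ↦ x + 1 would be a
  -- fixed-point-free involution of the q elements, making q even
  two≉0 : two ≉ 0#
  two≉0 two≈0 = q-odd (FixedPointFreeInvolution.even-order q succ succ-involutive succ-no-fixed-point)
    where
    succ : Fin q → Fin q
    succ i = proj₁ (enum-surj (enum i + 1#))
    enum-succ : ∀ i → enum (succ i) ≈ enum i + 1#
    enum-succ i = proj₂ (enum-surj (enum i + 1#))
    add-two : ∀ x → x + 1# + 1# ≈ x + two
    add-two = solve 1 (λ x → x :+ con (+ 1) :+ con (+ 1) := x :+ con (+ 2)) refl
    succ-involutive : ∀ i → succ (succ i) ≡ i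
    succ-involutive i = enum-inj _ _ (begin
      enum (succ (succ i)) ≈⟨ enum-succ (succ i) ⟩
      enum (succ i) + 1#   ≈⟨ +-congʳ (enum-succ i) ⟩
      enum i + 1# + 1#     ≈⟨ add-two (enum i) ⟩
      enum i + two         ≈⟨ +-congˡ two≈0 ⟩
      enum i + 0#          ≈⟨ +-identityʳ (enum i) ⟩
      enum i               ∎)
    succ-no-fixed-point : ∀ i → ¬ (succ i ≡ i)
    succ-no-fixed-point i e = 0≉1 (x∙y⁻¹≈ε⇒x≈y 0# 1# (begin
      0# - 1#                          ≈⟨ +-congʳ (x≈y⇒x∙y⁻¹≈ε (reflexive (P.cong enum e))) ⟨
      (enum (succ i) - enum i) - 1#    ≈⟨ +-congʳ (+-congʳ (enum-succ i)) ⟩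
      (enum i + 1# - enum i) - 1#      ≈⟨ cancel (enum i) ⟩
      0#                               ∎))
      where
      cancel : ∀ x → (x + 1# - x) - 1# ≈ 0#
      cancel = solve 1 (λ x → (x :+ con (+ 1) :- x) :- con (+ 1) := con (+ 0)) refl

  zero-product : ∀ a b → a * b ≈ 0# → a ≈ 0# ⊎ b ≈ 0#
  zero-product a b ab≈0 with a ≟ 0#
  ... | yes a≈0 = inj₁ a≈0
  ... | no a≉0 = inj₂ (begin
    b                ≈⟨ *-identityˡ b ⟨
    1# * b           ≈⟨ *-congʳ (inv-r a a≉0) ⟨
    (a * inv a) * b  ≈⟨ reorder a (inv a) b ⟩
    inv a * (a * b)  ≈⟨ *-congˡ ab≈0 ⟩
    inv a * 0#       ≈⟨ zeroʳ (inv a) ⟩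
    0#               ∎)
    where
    reorder : ∀ x y z → (x * y) * z ≈ y * (x * z)
    reorder = solve 3 (λ x y z → (x :* y) :* z := y :* (x :* z)) refl

  *-nonzero : ∀ {a b} → a ≉ 0# → b ≉ 0# → a * b ≉ 0#
  *-nonzero {a} {b} a≉0 b≉0 ab≈0 with zero-product a b ab≈0
  ... | inj₁ a≈0 = a≉0 a≈0
  ... | inj₂ b≈0 = b≉0 b≈0

  factor-nonzero : ∀ {a b c} → a * b ≈ c → c ≉ 0# → a ≉ 0#
  factor-nonzero {a} {b} {c} ab≈c c≉0 a≈0 = c≉0 (begin
    c       ≈⟨ ab≈c ⟨
    a * b   ≈⟨ *-congʳ a≈0 ⟩
    0# * b  ≈⟨ zeroˡ b ⟩
    0#      ∎)

  nonzero-resp : ∀ {a b} → a ≈ b → a ≉ 0# → b ≉ 0#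
  nonzero-resp a≈b a≉0 b≈0 = a≉0 (trans a≈b b≈0)

  minus-zero : ∀ x → x - 0# ≈ x
  minus-zero x = trans (+-congˡ -0#≈0#) (+-identityʳ x)

  difference-of-squares : ∀ x y → (x + y) * (x - y) ≈ x * x - y * y
  difference-of-squares = solve 2 (λ x y → (x :+ y) :* (x :- y) := x :* x :- y :* y) refl

  square-roots : ∀ x y → x * x ≈ y * y → x ≈ y ⊎ x ≈ - y
  square-roots x y x²≈y²
    with zero-product (x + y) (x - y) (trans (difference-of-squares x y) (x≈y⇒x∙y⁻¹≈ε x²≈y²))
  ... | inj₁ x+y≈0 = inj₂ (x∙y⁻¹≈ε⇒x≈y x (- y) (trans (+-congˡ (-‿involutive y)) x+y≈0))
  ... | inj₂ x-y≈0 = inj₁ (x∙y⁻¹≈ε⇒x≈y x y x-y≈0)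

  sum-nonzero : ∀ {r s k} → r * r - s * s ≈ k → k ≉ 0# → r + s ≉ 0#
  sum-nonzero {r} {s} r²-s²≈k = factor-nonzero (trans (difference-of-squares r s) r²-s²≈k)

  NZSquare-resp : ∀ {a b} → a ≈ b → NZSquare a → NZSquare b
  NZSquare-resp a≈b (a≉0 , r , r²≈a) = nonzero-resp a≈b a≉0 , r , trans r²≈a a≈b

  conditions-resp : ∀ {A : Set} {a b c a′ b′ c′} → a ≈ a′ → b ≈ b′ → c ≈ c′ →
    A ⇔ (NZSquare a × NZSquare b × NZSquare c) → A ⇔ (NZSquare a′ × NZSquare b′ × NZSquare c′)
  conditions-resp a≈a′ b≈b′ c≈c′ A⇔abc = mk⇔
    (λ A → let (sa , sb , sc) = to A⇔abc A in NZSquare-resp a≈a′ sa , NZSquare-resp b≈b′ sb , NZSquare-resp c≈c′ sc)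
    (λ (sa , sb , sc) → from A⇔abc (NZSquare-resp (sym a≈a′) sa , NZSquare-resp (sym b≈b′) sb , NZSquare-resp (sym c≈c′) sc))
    where open Equivalence using (to; from)

  difference-nonzero : ∀ {x y} → x ≉ y → x - y ≉ 0#
  difference-nonzero {x} {y} x≉y x-y≈0 = x≉y (x∙y⁻¹≈ε⇒x≈y x y x-y≈0)

  add-sub : ∀ e x → e + x - e ≈ x
  add-sub = solve 2 (λ e x → e :+ x :- e := x) refl

module LegendreDoubling (F : FiniteOddField) (d : FiniteOddField.Carrier F) where
  open FiniteOddField F
  open Legendre F
  open FieldFacts F
  open IntegerCoefficientSolver cring
  open import Algebra.Properties.Ring ring using (-‿involutive)
  open import Relation.Binary.Reasoning.Setoid setoid

  -- L_d : y² = x³ + a x² + d x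
  a : Carrier
  a = - (1# + d)

  -- the derivative of x(x-1)(x-d): the numerator of the tangent slope
  slope : Carrier → Carrier
  slope x = three * x * x + two * a * x + d

  double-x : Carrier → Carrier → Carrier
  double-x x μ = μ * μ - a - two * x

  double-y : Carrier → Carrier → Carrier → Carrier
  double-y x y μ = μ * (x - double-x x μ) - y

  double-cong : ∀ {x y μ μ′} → μ ≈ μ′ →
                double-x x μ ≈ double-x x μ′ × double-y x y μ ≈ double-y x y μ′
  double-cong μ≈μ′ = x-cong , +-congʳ (*-cong μ≈μ′ (+-congˡ (-‿cong x-cong)))
    where x-cong = +-congʳ (+-congʳ (*-cong μ≈μ′ μ≈μ′))

  aₚ : ∀ {n} → Polynomial n → Polynomial n
  aₚ δ = :- (con (+ 1) :+ δ)

  slopeₚ : ∀ {n} → Polynomial n → Polynomial n → Polynomial n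
  slopeₚ δ x = con (+ 3) :* x :* x :+ con (+ 2) :* aₚ δ :* x :+ δ

  rhsₚ : ∀ {n} → Polynomial n → Polynomial n → Polynomial n
  rhsₚ δ x = x :* (x :- con (+ 1)) :* (x :- δ)

  -- Necessity.  With w = 1/2y we have x(2Q) - e = μ² - c for
  -- c = a + 2x + e, and μ² - c = (slope² - 4 y² c) w²; so x(2Q) - e is a
  -- square as soon as slope² - 4·rhs·c is one.
  double-x-minus-root : ∀ {x y w} e N → y * y ≈ rhs d x → two * y * w ≈ 1# →
    slope x * slope x - two * two * rhs d x * (a + two * x + e) ≈ N * N →
    double-x x (slope x * w) - e ≈ (N * w) * (N * w)
  double-x-minus-root {x} {y} {w} e N on 2yw≈1 discriminant = begin
    double-x x (S * w) - e                          ≈⟨ collect S w a x e ⟩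
    (S * w) * (S * w) - c                           ≈⟨ +-congˡ (-‿cong c≈c·[2yw]²) ⟩
    (S * w) * (S * w) - c * ((two * y * w) * (two * y * w)) ≈⟨ expand S w c y ⟩
    (S * S - two * two * (y * y) * c) * (w * w)     ≈⟨ *-congʳ (+-congˡ (-‿cong (*-congʳ (*-congˡ on)))) ⟩
    (S * S - two * two * rhs d x * c) * (w * w)     ≈⟨ *-congʳ discriminant ⟩
    (N * N) * (w * w)                               ≈⟨ regroup N w ⟩
    (N * w) * (N * w)                               ∎
    where
    S : Carrier
    S = slope x
    c : Carrier
    c = a + two * x + e
    c≈c·[2yw]² : c ≈ c * ((two * y * w) * (two * y * w))
    c≈c·[2yw]² = sym (trans (*-congˡ (trans (*-cong 2yw≈1 2yw≈1) (*-identityʳ 1#))) (*-identityʳ c))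
    collect : ∀ S w a x e → (S * w) * (S * w) - a - two * x - e ≈ (S * w) * (S * w) - (a + two * x + e)
    collect = solve 5 (λ S w a x e →
      (S :* w) :* (S :* w) :- a :- con (+ 2) :* x :- e := (S :* w) :* (S :* w) :- (a :+ con (+ 2) :* x :+ e)) refl
    expand : ∀ S w c y → (S * w) * (S * w) - c * ((two * y * w) * (two * y * w)) ≈ (S * S - two * two * (y * y) * c) * (w * w)
    expand = solve 4 (λ S w c y →
      (S :* w) :* (S :* w) :- c :* ((con (+ 2) :* y :* w) :* (con (+ 2) :* y :* w))
        := (S :* S :- con (+ 2) :* con (+ 2) :* (y :* y) :* c) :* (w :* w)) refl
    regroup : ∀ N w → (N * N) * (w * w) ≈ (N * w) * (N * w)
    regroup = solve 2 (λ N w → (N :* N) :* (w :* w) := (N :* w) :* (N :* w)) refl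

  discriminant-0 : ∀ x → slope x * slope x - two * two * rhs d x * (a + two * x + 0#) ≈ (x * x - d) * (x * x - d)
  discriminant-0 x = solve 2 (λ δ x →
    slopeₚ δ x :* slopeₚ δ x :- con (+ 2) :* con (+ 2) :* rhsₚ δ x :* (aₚ δ :+ con (+ 2) :* x :+ con (+ 0))
      := (x :* x :- δ) :* (x :* x :- δ)) refl d x

  discriminant-1 : ∀ x → slope x * slope x - two * two * rhs d x * (a + two * x + 1#)
                         ≈ (x * x - two * x + d) * (x * x - two * x + d)
  discriminant-1 x = solve 2 (λ δ x →
    slopeₚ δ x :* slopeₚ δ x :- con (+ 2) :* con (+ 2) :* rhsₚ δ x :* (aₚ δ :+ con (+ 2) :* x :+ con (+ 1))
      := (x :* x :- con (+ 2) :* x :+ δ) :* (x :* x :- con (+ 2) :* x :+ δ)) refl d x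

  discriminant-d : ∀ x → slope x * slope x - two * two * rhs d x * (a + two * x + d)
                         ≈ (x * x - two * d * x + d) * (x * x - two * d * x + d)
  discriminant-d x = solve 2 (λ δ x →
    slopeₚ δ x :* slopeₚ δ x :- con (+ 2) :* con (+ 2) :* rhsₚ δ x :* (aₚ δ :+ con (+ 2) :* x :+ δ)
      := (x :* x :- con (+ 2) :* δ :* x :+ δ) :* (x :* x :- con (+ 2) :* δ :* x :+ δ)) refl d x

  doubles-have-square-differences : ∀ {x y x₀ y₀} → OnCurve d (just (x , y)) →
    dbl d (just (x , y)) ≈P just (x₀ , y₀) →
    (∃ λ r → r * r ≈ x₀) × (∃ λ r → r * r ≈ x₀ - 1#) × (∃ λ r → r * r ≈ x₀ - d)
  doubles-have-square-differences {x} {y} {x₀} on 2Q≈P with y ≟ 0#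
  ... | yes _ = ⊥-elim 2Q≈P
  ... | no y≉0 =
      (_ , trans (square-of 0# _ (discriminant-0 x)) (minus-zero x₀))
    , (_ , square-of 1# _ (discriminant-1 x))
    , (_ , square-of d _ (discriminant-d x))
    where
    w : Carrier
    w = inv (two * y)
    square-of : ∀ e N → slope x * slope x - two * two * rhs d x * (a + two * x + e) ≈ N * N →
                (N * w) * (N * w) ≈ x₀ - e
    square-of e N discriminant =
      trans (sym (double-x-minus-root e N on (inv-r _ (*-nonzero two≉0 y≉0)) discriminant))
            (+-congʳ (proj₁ 2Q≈P))

  -- Sufficiency: halving an affine point from square roots r₁, r₂, r₃ of
  -- x₀, x₀ - 1, x₀ - d.  The key facts are the factorisations of X - e.
  module Halving {x₀ r₁ r₂ r₃ : Carrier}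
    (h₁ : r₁ * r₁ ≈ x₀) (h₂ : r₂ * r₂ ≈ x₀ - 1#) (h₃ : r₃ * r₃ ≈ x₀ - d) where

    σ : Carrier
    σ = r₁ * r₂ + r₁ * r₃ + r₂ * r₃

    X Y L : Carrier
    X = x₀ + σ
    Y = (r₁ + r₂) * (r₁ + r₃) * (r₂ + r₃)
    L = r₁ + r₂ + r₃

    shift : ∀ e → X - e ≈ (x₀ - e) + σ
    shift e = solve 3 (λ x₀ σ e → (x₀ :+ σ) :- e := (x₀ :- e) :+ σ) refl x₀ σ e

    X-factors : X ≈ (r₁ + r₂) * (r₁ + r₃)
    X-factors = trans (+-congʳ (sym h₁))
      (solve 3 (λ r₁ r₂ r₃ → r₁ :* r₁ :+ (r₁ :* r₂ :+ r₁ :* r₃ :+ r₂ :* r₃) := (r₁ :+ r₂) :* (r₁ :+ r₃)) refl r₁ r₂ r₃)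

    X-1-factors : X - 1# ≈ (r₁ + r₂) * (r₂ + r₃)
    X-1-factors = trans (shift 1#) (trans (+-congʳ (sym h₂))
      (solve 3 (λ r₁ r₂ r₃ → r₂ :* r₂ :+ (r₁ :* r₂ :+ r₁ :* r₃ :+ r₂ :* r₃) := (r₁ :+ r₂) :* (r₂ :+ r₃)) refl r₁ r₂ r₃))

    X-d-factors : X - d ≈ (r₁ + r₃) * (r₂ + r₃)
    X-d-factors = trans (shift d) (trans (+-congʳ (sym h₃))
      (solve 3 (λ r₁ r₂ r₃ → r₃ :* r₃ :+ (r₁ :* r₂ :+ r₁ :* r₃ :+ r₂ :* r₃) := (r₁ :+ r₃) :* (r₂ :+ r₃)) refl r₁ r₂ r₃))

    on-curve : Y * Y ≈ rhs d X
    on-curve = sym (begin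
      X * (X - 1#) * (X - d)                                             ≈⟨ *-cong (*-cong X-factors X-1-factors) X-d-factors ⟩
      ((r₁ + r₂) * (r₁ + r₃)) * ((r₁ + r₂) * (r₂ + r₃)) * ((r₁ + r₃) * (r₂ + r₃)) ≈⟨ regroup r₁ r₂ r₃ ⟩
      Y * Y                                                              ∎)
      where
      regroup : ∀ r₁ r₂ r₃ → ((r₁ + r₂) * (r₁ + r₃)) * ((r₁ + r₂) * (r₂ + r₃)) * ((r₁ + r₃) * (r₂ + r₃))
                             ≈ ((r₁ + r₂) * (r₁ + r₃) * (r₂ + r₃)) * ((r₁ + r₂) * (r₁ + r₃) * (r₂ + r₃))
      regroup = solve 3 (λ r₁ r₂ r₃ →
        ((r₁ :+ r₂) :* (r₁ :+ r₃)) :* ((r₁ :+ r₂) :* (r₂ :+ r₃)) :* ((r₁ :+ r₃) :* (r₂ :+ r₃))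
          := ((r₁ :+ r₂) :* (r₁ :+ r₃) :* (r₂ :+ r₃)) :* ((r₁ :+ r₂) :* (r₁ :+ r₃) :* (r₂ :+ r₃))) refl

    -- the derivative of the cubic is the sum of the pairwise products of
    -- its linear factors, hence slope X = 2·Y·L
    slope-at-X : slope X ≈ two * Y * L
    slope-at-X = begin
      slope X                                             ≈⟨ product-rule X ⟩
      (X - 1#) * (X - d) + X * (X - d) + X * (X - 1#)     ≈⟨ +-cong (+-cong (*-cong X-1-factors X-d-factors)
                                                                              (*-cong X-factors X-d-factors))
                                                                     (*-cong X-factors X-1-factors) ⟩
      ((r₁ + r₂) * (r₂ + r₃)) * ((r₁ + r₃) * (r₂ + r₃)) + ((r₁ + r₂) * (r₁ + r₃)) * ((r₁ + r₃) * (r₂ + r₃))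
        + ((r₁ + r₂) * (r₁ + r₃)) * ((r₁ + r₂) * (r₂ + r₃)) ≈⟨ collect r₁ r₂ r₃ ⟩
      two * Y * L                                         ∎
      where
      product-rule : ∀ x → slope x ≈ (x - 1#) * (x - d) + x * (x - d) + x * (x - 1#)
      product-rule x = solve 2 (λ δ x →
        slopeₚ δ x := (x :- con (+ 1)) :* (x :- δ) :+ x :* (x :- δ) :+ x :* (x :- con (+ 1))) refl d x
      collect : ∀ r₁ r₂ r₃ →
        ((r₁ + r₂) * (r₂ + r₃)) * ((r₁ + r₃) * (r₂ + r₃)) + ((r₁ + r₂) * (r₁ + r₃)) * ((r₁ + r₃) * (r₂ + r₃))
          + ((r₁ + r₂) * (r₁ + r₃)) * ((r₁ + r₂) * (r₂ + r₃))
        ≈ two * ((r₁ + r₂) * (r₁ + r₃) * (r₂ + r₃)) * (r₁ + r₂ + r₃)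
      collect = solve 3 (λ r₁ r₂ r₃ →
        ((r₁ :+ r₂) :* (r₂ :+ r₃)) :* ((r₁ :+ r₃) :* (r₂ :+ r₃)) :+ ((r₁ :+ r₂) :* (r₁ :+ r₃)) :* ((r₁ :+ r₃) :* (r₂ :+ r₃))
          :+ ((r₁ :+ r₂) :* (r₁ :+ r₃)) :* ((r₁ :+ r₂) :* (r₂ :+ r₃))
        := con (+ 2) :* ((r₁ :+ r₂) :* (r₁ :+ r₃) :* (r₂ :+ r₃)) :* (r₁ :+ r₂ :+ r₃)) refl

    halved-x : double-x X L ≈ x₀
    halved-x = begin
      L * L - a - two * X                                      ≈⟨ expand r₁ r₂ r₃ x₀ d ⟩
      (r₁ * r₁ + r₂ * r₂ + r₃ * r₃) + (1# + d) - two * x₀      ≈⟨ +-congʳ (+-congʳ (+-cong (+-cong h₁ h₂) h₃)) ⟩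
      (x₀ + (x₀ - 1#) + (x₀ - d)) + (1# + d) - two * x₀        ≈⟨ cancel x₀ d ⟩
      x₀                                                       ∎
      where
      expand : ∀ r₁ r₂ r₃ x₀ δ →
        (r₁ + r₂ + r₃) * (r₁ + r₂ + r₃) - - (1# + δ) - two * (x₀ + (r₁ * r₂ + r₁ * r₃ + r₂ * r₃))
        ≈ (r₁ * r₁ + r₂ * r₂ + r₃ * r₃) + (1# + δ) - two * x₀
      expand = solve 5 (λ r₁ r₂ r₃ x₀ δ →
        (r₁ :+ r₂ :+ r₃) :* (r₁ :+ r₂ :+ r₃) :- aₚ δ :- con (+ 2) :* (x₀ :+ (r₁ :* r₂ :+ r₁ :* r₃ :+ r₂ :* r₃))
          := (r₁ :* r₁ :+ r₂ :* r₂ :+ r₃ :* r₃) :+ (con (+ 1) :+ δ) :- con (+ 2) :* x₀) refl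
      cancel : ∀ x₀ δ → (x₀ + (x₀ - 1#) + (x₀ - δ)) + (1# + δ) - two * x₀ ≈ x₀
      cancel = solve 2 (λ x₀ δ →
        (x₀ :+ (x₀ :- con (+ 1)) :+ (x₀ :- δ)) :+ (con (+ 1) :+ δ) :- con (+ 2) :* x₀ := x₀) refl

    halved-y : double-y X Y L ≈ r₁ * r₂ * r₃
    halved-y = begin
      L * (X - double-x X L) - Y    ≈⟨ +-congʳ (*-congˡ (+-congˡ (-‿cong halved-x))) ⟩
      L * (X - x₀) - Y              ≈⟨ cancel r₁ r₂ r₃ x₀ ⟩
      r₁ * r₂ * r₃                  ∎
      where
      cancel : ∀ r₁ r₂ r₃ x₀ → (r₁ + r₂ + r₃) * ((x₀ + (r₁ * r₂ + r₁ * r₃ + r₂ * r₃)) - x₀)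
                                 - (r₁ + r₂) * (r₁ + r₃) * (r₂ + r₃) ≈ r₁ * r₂ * r₃
      cancel = solve 4 (λ r₁ r₂ r₃ x₀ →
        (r₁ :+ r₂ :+ r₃) :* ((x₀ :+ (r₁ :* r₂ :+ r₁ :* r₃ :+ r₂ :* r₃)) :- x₀)
          :- (r₁ :+ r₂) :* (r₁ :+ r₃) :* (r₂ :+ r₃) := r₁ :* r₂ :* r₃) refl

    -- Y ≠ 0 since (r₁+r₂)(r₁-r₂) = 1, (r₁+r₃)(r₁-r₃) = d, (r₂+r₃)(r₂-r₃) = d - 1
    Y-nonzero : d ≉ 0# → d - 1# ≉ 0# → Y ≉ 0#
    Y-nonzero d≉0 d-1≉0 = *-nonzero (*-nonzero r₁+r₂≉0 r₁+r₃≉0) r₂+r₃≉0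
      where
      difference : ∀ x₀ e → x₀ - (x₀ - e) ≈ e
      difference = solve 2 (λ x₀ e → x₀ :- (x₀ :- e) := e) refl
      r₁+r₂≉0 : r₁ + r₂ ≉ 0#
      r₁+r₂≉0 = sum-nonzero (trans (+-cong h₁ (-‿cong h₂)) (difference x₀ 1#)) (λ 1≈0 → 0≉1 (sym 1≈0))
      r₁+r₃≉0 : r₁ + r₃ ≉ 0#
      r₁+r₃≉0 = sum-nonzero (trans (+-cong h₁ (-‿cong h₃)) (difference x₀ d)) d≉0
      r₂+r₃≉0 : r₂ + r₃ ≉ 0#
      r₂+r₃≉0 = sum-nonzero (trans (+-cong h₂ (-‿cong h₃))
        (solve 2 (λ x₀ δ → (x₀ :- con (+ 1)) :- (x₀ :- δ) := δ :- con (+ 1)) refl x₀ d)) d-1≉0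

    halves : d ≉ 0# → d - 1# ≉ 0# →
             OnCurve d (just (X , Y)) × (dbl d (just (X , Y)) ≈P just (x₀ , r₁ * r₂ * r₃))
    halves d≉0 d-1≉0 with Y ≟ 0#
    ... | yes Y≈0 = ⊥-elim (Y-nonzero d≉0 d-1≉0 Y≈0)
    ... | no Y≉0 = on-curve , trans (proj₁ μ≈L) halved-x , trans (proj₂ μ≈L) halved-y
      where
      w : Carrier
      w = inv (two * Y)
      slope-w≈L : slope X * w ≈ L
      slope-w≈L = begin
        slope X * w          ≈⟨ *-congʳ slope-at-X ⟩
        two * Y * L * w      ≈⟨ solve 3 (λ t L w → t :* L :* w := L :* (t :* w)) refl (two * Y) L w ⟩
        L * (two * Y * w)    ≈⟨ *-congˡ (inv-r _ (*-nonzero two≉0 Y≉0)) ⟩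
        L * 1#               ≈⟨ *-identityʳ L ⟩
        L                    ∎
      μ≈L : double-x X (slope X * w) ≈ double-x X L × double-y X Y (slope X * w) ≈ double-y X Y L
      μ≈L = double-cong {X} {Y} slope-w≈L

  ≈P-just : ∀ {Q x y y′} → Q ≈P just (x , y) → y ≈ y′ → Q ≈P just (x , y′)
  ≈P-just {nothing} ()
  ≈P-just {just _} (x-eq , y-eq) y≈y′ = x-eq , trans y-eq y≈y′

  halving-criterion : d ≉ 0# → d - 1# ≉ 0# → ∀ {x₀ y₀} → OnCurve d (just (x₀ , y₀)) →
    x₀ ≉ 0# × x₀ - 1# ≉ 0# × x₀ - d ≉ 0# →
    InTwoL d (just (x₀ , y₀)) ⇔ (NZSquare x₀ × NZSquare (x₀ - 1#) × NZSquare (x₀ - d))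
  halving-criterion d≉0 d-1≉0 {x₀} {y₀} on (x₀≉0 , x₀-1≉0 , x₀-d≉0) = mk⇔ necessary sufficient
    where
    necessary : InTwoL d (just (x₀ , y₀)) → NZSquare x₀ × NZSquare (x₀ - 1#) × NZSquare (x₀ - d)
    necessary (nothing , _ , ())
    necessary (just (x , y) , onQ , 2Q≈P) with doubles-have-square-differences {x} {y} onQ 2Q≈P
    ... | root₀ , root₁ , root-d = (x₀≉0 , root₀) , (x₀-1≉0 , root₁) , (x₀-d≉0 , root-d)

    halving-point : ∀ {r₁ r₂ r₃} → r₁ * r₁ ≈ x₀ → r₂ * r₂ ≈ x₀ - 1# → r₃ * r₃ ≈ x₀ - d →
                    r₁ * r₂ * r₃ ≈ y₀ → InTwoL d (just (x₀ , y₀))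
    halving-point h₁ h₂ h₃ r₁r₂r₃≈y₀ =
      just (X , Y) , proj₁ (halves d≉0 d-1≉0) , ≈P-just (proj₂ (halves d≉0 d-1≉0)) r₁r₂r₃≈y₀
      where open Halving h₁ h₂ h₃

    -- r₁r₂r₃ is a square root of x₀(x₀ - 1)(x₀ - d) = y₀², hence ±y₀
    product-squared : ∀ {r₁ r₂ r₃} → r₁ * r₁ ≈ x₀ → r₂ * r₂ ≈ x₀ - 1# → r₃ * r₃ ≈ x₀ - d →
                      (r₁ * r₂ * r₃) * (r₁ * r₂ * r₃) ≈ y₀ * y₀
    product-squared {r₁} {r₂} {r₃} h₁ h₂ h₃ = begin
      (r₁ * r₂ * r₃) * (r₁ * r₂ * r₃)       ≈⟨ regroup r₁ r₂ r₃ ⟩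
      (r₁ * r₁) * (r₂ * r₂) * (r₃ * r₃)     ≈⟨ *-cong (*-cong h₁ h₂) h₃ ⟩
      rhs d x₀                              ≈⟨ on ⟨
      y₀ * y₀                               ∎
      where
      regroup : ∀ r₁ r₂ r₃ → (r₁ * r₂ * r₃) * (r₁ * r₂ * r₃) ≈ (r₁ * r₁) * (r₂ * r₂) * (r₃ * r₃)
      regroup = solve 3 (λ r₁ r₂ r₃ → (r₁ :* r₂ :* r₃) :* (r₁ :* r₂ :* r₃) := (r₁ :* r₁) :* (r₂ :* r₂) :* (r₃ :* r₃)) refl

    sufficient : NZSquare x₀ × NZSquare (x₀ - 1#) × NZSquare (x₀ - d) → InTwoL d (just (x₀ , y₀))
    sufficient ((_ , r₁ , h₁) , (_ , r₂ , h₂) , (_ , r₃ , h₃))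
      with square-roots (r₁ * r₂ * r₃) y₀ (product-squared h₁ h₂ h₃)
    ... | inj₁ r₁r₂r₃≈y₀ = halving-point h₁ h₂ h₃ r₁r₂r₃≈y₀
    ... | inj₂ r₁r₂r₃≈-y₀ = halving-point (trans (negated-square r₁) h₁) h₂ h₃ (begin
      (- r₁) * r₂ * r₃      ≈⟨ negated-product r₁ r₂ r₃ ⟩
      - (r₁ * r₂ * r₃)      ≈⟨ -‿cong r₁r₂r₃≈-y₀ ⟩
      - - y₀                ≈⟨ -‿involutive y₀ ⟩
      y₀                    ∎)
      where
      negated-square : ∀ r → (- r) * (- r) ≈ r * r
      negated-square = solve 1 (λ r → (:- r) :* (:- r) := r :* r) refl
      negated-product : ∀ r₁ r₂ r₃ → (- r₁) * r₂ * r₃ ≈ - (r₁ * r₂ * r₃)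
      negated-product = solve 3 (λ r₁ r₂ r₃ → (:- r₁) :* r₂ :* r₃ := :- (r₁ :* r₂ :* r₃)) refl

module FourTorsionAbscissae (F : FiniteOddField) {d : FiniteOddField.Carrier F} where
  open FiniteOddField F
  open FieldFacts F
  open IntegerCoefficientSolver cring
  open import Relation.Binary.Reasoning.Setoid setoid

  abscissa-i : d ≉ 0# → d - 1# ≉ 0# → ∀ {s} → s * s ≈ d → s ≉ 0# × s - 1# ≉ 0# × s - d ≉ 0#
  abscissa-i d≉0 d-1≉0 {s} s²≈d = s≉0 , s-1≉0 , factor-nonzero s-d·[-1]≈s[s-1] (*-nonzero s≉0 s-1≉0)
    where
    s≉0 : s ≉ 0#
    s≉0 = factor-nonzero s²≈d d≉0
    s-1≉0 : s - 1# ≉ 0#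
    s-1≉0 = factor-nonzero (trans (solve 1 (λ s → (s :- con (+ 1)) :* (s :+ con (+ 1)) := s :* s :- con (+ 1)) refl s)
                                  (+-congʳ s²≈d)) d-1≉0
    s-d·[-1]≈s[s-1] : (s - d) * (- 1#) ≈ s * (s - 1#)
    s-d·[-1]≈s[s-1] = begin
      (s - d) * (- 1#)  ≈⟨ solve 2 (λ s δ → (s :- δ) :* (:- con (+ 1)) := δ :- s) refl s d ⟩
      d - s             ≈⟨ +-congʳ s²≈d ⟨
      s * s - s         ≈⟨ solve 1 (λ s → s :* s :- s := s :* (s :- con (+ 1))) refl s ⟩
      s * (s - 1#)      ∎

  abscissa-ii : d ≉ 0# → d - 1# ≉ 0# → ∀ {t} → t * t ≈ 1# - d →
                1# + t ≉ 0# × 1# + t - 1# ≉ 0# × 1# + t - d ≉ 0#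
  abscissa-ii d≉0 d-1≉0 {t} t²≈1-d =
    1+t≉0 , nonzero-resp (sym (add-sub 1# t)) t≉0 , nonzero-resp t[1+t]≈1+t-d (*-nonzero t≉0 1+t≉0)
    where
    1+t≉0 : 1# + t ≉ 0#
    1+t≉0 = factor-nonzero (begin
      (1# + t) * (1# - t)  ≈⟨ solve 1 (λ t → (con (+ 1) :+ t) :* (con (+ 1) :- t) := con (+ 1) :- t :* t) refl t ⟩
      1# - t * t           ≈⟨ +-congˡ (-‿cong t²≈1-d) ⟩
      1# - (1# - d)        ≈⟨ solve 1 (λ δ → con (+ 1) :- (con (+ 1) :- δ) := δ) refl d ⟩
      d                    ∎) d≉0
    t≉0 : t ≉ 0#
    t≉0 = factor-nonzero (begin
      t * (- t)            ≈⟨ solve 1 (λ t → t :* (:- t) := :- (t :* t)) refl t ⟩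
      - (t * t)            ≈⟨ -‿cong t²≈1-d ⟩
      - (1# - d)           ≈⟨ solve 1 (λ δ → :- (con (+ 1) :- δ) := δ :- con (+ 1)) refl d ⟩
      d - 1#               ∎) d-1≉0
    t[1+t]≈1+t-d : t * (1# + t) ≈ 1# + t - d
    t[1+t]≈1+t-d = begin
      t * (1# + t)         ≈⟨ solve 1 (λ t → t :* (con (+ 1) :+ t) := t :+ t :* t) refl t ⟩
      t + t * t            ≈⟨ +-congˡ t²≈1-d ⟩
      t + (1# - d)         ≈⟨ solve 2 (λ t δ → t :+ (con (+ 1) :- δ) := con (+ 1) :+ t :- δ) refl t d ⟩
      1# + t - d           ∎

  abscissa-iii : d ≉ 0# → d - 1# ≉ 0# → ∀ {u} → u * u ≈ d * (d - 1#) →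
                 d + u ≉ 0# × d + u - 1# ≉ 0# × d + u - d ≉ 0#
  abscissa-iii d≉0 d-1≉0 {u} u²≈d[d-1] =
    d+u≉0 , d+u-1≉0 , nonzero-resp (sym (add-sub d u)) (factor-nonzero u²≈d[d-1] (*-nonzero d≉0 d-1≉0))
    where
    d+u≉0 : d + u ≉ 0#
    d+u≉0 = factor-nonzero (begin
      (d + u) * (d - u)            ≈⟨ solve 2 (λ δ u → (δ :+ u) :* (δ :- u) := δ :* δ :- u :* u) refl d u ⟩
      d * d - u * u                ≈⟨ +-congˡ (-‿cong u²≈d[d-1]) ⟩
      d * d - d * (d - 1#)         ≈⟨ solve 1 (λ δ → δ :* δ :- δ :* (δ :- con (+ 1)) := δ) refl d ⟩
      d                            ∎) d≉0
    d+u-1≉0 : d + u - 1# ≉ 0#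
    d+u-1≉0 = factor-nonzero (begin
      (d + u - 1#) * (1# + u - d)  ≈⟨ solve 2 (λ δ u → (δ :+ u :- con (+ 1)) :* (con (+ 1) :+ u :- δ)
                                                      := u :* u :- (δ :- con (+ 1)) :* (δ :- con (+ 1))) refl d u ⟩
      u * u - (d - 1#) * (d - 1#)  ≈⟨ +-congʳ u²≈d[d-1] ⟩
      d * (d - 1#) - (d - 1#) * (d - 1#) ≈⟨ solve 1 (λ δ → δ :* (δ :- con (+ 1)) :- (δ :- con (+ 1)) :* (δ :- con (+ 1))
                                                      := δ :- con (+ 1)) refl d ⟩
      d - 1#                       ∎) d-1≉0

lemma7p1 : (F : FiniteOddField) →
    let open FiniteOddField F
        open Legendre F
    in (d : Carrier) → d ≉ 0# → d ≉ 1# →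
       (((s y : Carrier) → s * s ≈ d → OnCurve d (just (s , y)) →
           InTwoL d (just (s , y)) ⇔ (NZSquare s × NZSquare (s - 1#) × NZSquare (s - d)))
       × ((t y : Carrier) → t * t ≈ 1# - d → OnCurve d (just (1# + t , y)) →
           InTwoL d (just (1# + t , y)) ⇔ (NZSquare (1# + t) × NZSquare t × NZSquare (1# + t - d)))
       × ((u y : Carrier) → u * u ≈ d * (d - 1#) → OnCurve d (just (d + u , y)) →
           InTwoL d (just (d + u , y)) ⇔ (NZSquare (d + u) × NZSquare (d + u - 1#) × NZSquare u)))
lemma7p1 F d d≉0 d≉1 =
    (λ s _ s²≈d on → halving-criterion d≉0 d-1≉0 on (abscissa-i d≉0 d-1≉0 s²≈d))
  , (λ t _ t²≈1-d on → conditions-resp refl (add-sub 1# t) refl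
                         (halving-criterion d≉0 d-1≉0 on (abscissa-ii d≉0 d-1≉0 t²≈1-d)))
  , (λ u _ u²≈d[d-1] on → conditions-resp refl refl (add-sub d u)
                            (halving-criterion d≉0 d-1≉0 on (abscissa-iii d≉0 d-1≉0 u²≈d[d-1])))
  where
  open FiniteOddField F using (refl; 1#; 0#; _-_; _≉_)
  open FieldFacts F using (difference-nonzero; conditions-resp; add-sub)
  open FourTorsionAbscissae F
  open LegendreDoubling F d using (halving-criterion)
  d-1≉0 : d - 1# ≉ 0#
  d-1≉0 = difference-nonzero d≉1
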